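{- The function $\mathrm{Prove}$ terminates for any input nested sequent $\Xi$.
   Context: Formulae are in negation normal form over $a,\neg a,\lor,\land,\square,\blacksquare,\lozenge,\lozenge^{\bullet}$, where $\lozenge^{\bullet}$ is the past diamond (dual of $\blacksquare$). A nested sequent is viewed as a tree whose nodes carry sets of formulae $S(u)$ and whose edges are labelled $\circ$ or $\bullet$ (children are $\circ$-children or $\bullet$-children). The deep calculus $\mathbf{DKt}$ has rules (with $\Sigma[\,]$ a context with a hole at any node): $id$: $\Sigma[a,\overline a]$; $\land$: from $\Sigma[A\land B,A]$, $\Sigma[A\land B,B]$ infer $\Sigma[A\land B]$; $\lor$: from $\Sigma[A\lor B,A,B]$ infer $\Sigma[A\lor B]$; $\blacksquare$: from $\Sigma[\blacksquare A,\bullet\{A\}]$ infer $\Sigma[\blacksquare A]$; $\square$: from $\Sigma[\square A,\circ\{A\}]$ infer $\Sigma[\square A]$; $\lozenge^{\bullet}_1$: from $\Sigma[\bullet\{\Delta,A\},\lozenge^{\bullet}A]$ infer $\Sigma[\bullet\{\Delta\},\lozenge^{\bullet}A]$; $\lozenge^{\bullet}_2$: from $\Sigma[\circ\{\Delta,\lozenge^{\bullet}A\},A]$ infer $\Sigma[\circ\{\Delta,\lozenge^{\bullet}A\}]$; $\lozenge_1$: from $\Sigma[\circ\{\Delta,A\},\lozenge A]$ infer $\Sigma[\circ\{\Delta\},\lozenge A]$; $\lozenge_2$: from $\Sigma[\bullet\{\Delta,\lozenge A\},A]$ infer $\Sigma[\bullet\{\Delta,\lozenge A\}]$. A node $u$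 is saturated if: $A\lor B\in S(u)$ implies $A,B\in S(u)$; $A\land B\in S(u)$ implies $A\in S(u)$ or $B\in S(u)$; no atom $p$ has both $p,\neg p\in S(u)$. $\square A\in S(u)$ ($\blacksquare A\in S(u)$) is realised if some $\circ$-child ($\bullet$-child) $v$ of $u$ has $A\in S(v)$. Node $u$ is propagated if: for every $\lozenge A\in S(u)$ and $\circ$-child $v$, $A\in S(v)$; for every $\lozenge^{\bullet}A\in S(u)$ and $\bullet$-child $v$, $A\in S(v)$; for every $\bullet$-child $v$ and $\lozenge A\in S(v)$, $A\in S(u)$; for every $\circ$-child $v$ and $\lozenge^{\bullet}A\in S(v)$, $A\in S(u)$. $\mathrm{Prove}(\Xi)$: let $T$ be the tree of $\Xi$. (1) If $id$ applies at some node, return True. (2) Else if some node is not saturated: if $A\lor B\in\Theta$ with $A\notin\Theta$ or $B\notin\Theta$, return $\mathrm{Prove}$ of the premise of $\lor$ applied there; if $A\land B\in\Theta$ with $A\notin\Theta$ and $B\notin\Theta$, return True iff $\mathrm{Prove}$ returns True on both premises of $\land$ applied there. (3) Else if some $\square A$ or $\blacksquare A$ at some node is not realised, return $\mathrm{Prove}$ of the premise of the $\square$ (resp. $\blacksquare$) rule applied to it. (4) Else if some node is not propagated, return $\mathrm{Prove}$ of the premise of the rule among $\lozenge_1,\lozenge^{\bullet}_1,\lozenge_2,\lozenge^{\bullet}_2$ corresponding to the violated propagation condition. (5) Else return False. -}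

module Defs where

open import Data.Nat using (ℕ)
open import Data.List using (List; []; _∷_; _++_)
open import Data.List.Membership.Propositional using (_∈_; _∉_)
open import Data.Product using (Σ; _×_; _,_; ∃)
open import Data.Sum using (_⊎_)
open import Data.Empty using (⊥)
open import Relation.Nullary using (¬_)
open import Relation.Binary.PropositionalEquality using (_≡_)

infixr 6 _∨_
infixr 7 _∧_

-- Formulae in negation normal form; atoms are indexed by ℕ.
-- ◆ is the past diamond (dual of ■).
data Fml : Set where
  pos neg : ℕ → Fml
  _∨_ _∧_ : Fml → Fml → Fml
  □ ■ ◇ ◆ : Fml → Fml

-- Edge labels: white = ∘ , black = •
data Lbl : Set where
  white black : Lbl

-- A nested sequent as a tree: each node carries a (finite) set S(u) of
-- formulae (represented by a list, only membership matters) and a list of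
-- labelled children.
data Seq : Set where
  node : List Fml → List (Lbl × Seq) → Seq

-- Contexts Σ[ ] with the hole at an arbitrary node (a zipper).
data Ctx : Set where
  hole  : Ctx
  under : List Fml → List (Lbl × Seq) → Lbl → Ctx → List (Lbl × Seq) → Ctx

plug : Ctx → Seq → Seq
plug hole t = t
plug (under Γ l₁ x C l₂) t = node Γ (l₁ ++ (x , plug C t) ∷ l₂)

IdApplies : Seq → Set
IdApplies Ξ = Σ Ctx λ C → Σ (List Fml) λ Γ → Σ (List (Lbl × Seq)) λ ch →
  Σ ℕ λ p → Ξ ≡ plug C (node Γ ch) × pos p ∈ Γ × neg p ∈ Γ

Saturated : List Fml → Set
Saturated Γ =
  (∀ A B → (A ∨ B) ∈ Γ → A ∈ Γ × B ∈ Γ) ×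
  (∀ A B → (A ∧ B) ∈ Γ → A ∈ Γ ⊎ B ∈ Γ) ×
  (∀ p → pos p ∈ Γ → neg p ∈ Γ → ⊥)

AllSaturated : Seq → Set
AllSaturated Ξ = ∀ C Γ ch → Ξ ≡ plug C (node Γ ch) → Saturated Γ

HasChildWith : Lbl → Fml → List (Lbl × Seq) → Set
HasChildWith x A ch = Σ (List Fml) λ Δ → Σ (List (Lbl × Seq)) λ ch' →
  (x , node Δ ch') ∈ ch × A ∈ Δ

RealisedNode : List Fml → List (Lbl × Seq) → Set
RealisedNode Γ ch =
  (∀ A → □ A ∈ Γ → HasChildWith white A ch) ×
  (∀ A → ■ A ∈ Γ → HasChildWith black A ch)

AllRealised : Seq → Set
AllRealised Ξ = ∀ C Γ ch → Ξ ≡ plug C (node Γ ch) → RealisedNode Γ ch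

-- Calls Ξ Ξ' : one execution of Prove(Ξ) makes a recursive call Prove(Ξ'),
-- following the priority order (1)-(5) of the algorithm; every admissible
-- choice of node / formula / child is allowed.
data Calls (Ξ : Seq) : Seq → Set where
  c∨ : ∀ C Γ ch A B → ¬ IdApplies Ξ → Ξ ≡ plug C (node Γ ch) →
       (A ∨ B) ∈ Γ → (A ∉ Γ ⊎ B ∉ Γ) →
       Calls Ξ (plug C (node (A ∷ B ∷ Γ) ch))
  c∧₁ : ∀ C Γ ch A B → ¬ IdApplies Ξ → Ξ ≡ plug C (node Γ ch) →
       (A ∧ B) ∈ Γ → A ∉ Γ → B ∉ Γ →
       Calls Ξ (plug C (node (A ∷ Γ) ch))
  c∧₂ : ∀ C Γ ch A B → ¬ IdApplies Ξ → Ξ ≡ plug C (node Γ ch) →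
       (A ∧ B) ∈ Γ → A ∉ Γ → B ∉ Γ →
       Calls Ξ (plug C (node (B ∷ Γ) ch))
  c□ : ∀ C Γ ch A → ¬ IdApplies Ξ → AllSaturated Ξ → Ξ ≡ plug C (node Γ ch) →
       □ A ∈ Γ → ¬ HasChildWith white A ch →
       Calls Ξ (plug C (node Γ ((white , node (A ∷ []) []) ∷ ch)))
  c■ : ∀ C Γ ch A → ¬ IdApplies Ξ → AllSaturated Ξ → Ξ ≡ plug C (node Γ ch) →
       ■ A ∈ Γ → ¬ HasChildWith black A ch →
       Calls Ξ (plug C (node Γ ((black , node (A ∷ []) []) ∷ ch)))
  c◇₁ : ∀ C Γ ch₁ Δ ch' ch₂ A → ¬ IdApplies Ξ → AllSaturated Ξ → AllRealised Ξ →
       Ξ ≡ plug C (node Γ (ch₁ ++ (white , node Δ ch') ∷ ch₂)) →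
       ◇ A ∈ Γ → A ∉ Δ →
       Calls Ξ (plug C (node Γ (ch₁ ++ (white , node (A ∷ Δ) ch') ∷ ch₂)))
  c◆₁ : ∀ C Γ ch₁ Δ ch' ch₂ A → ¬ IdApplies Ξ → AllSaturated Ξ → AllRealised Ξ →
       Ξ ≡ plug C (node Γ (ch₁ ++ (black , node Δ ch') ∷ ch₂)) →
       ◆ A ∈ Γ → A ∉ Δ →
       Calls Ξ (plug C (node Γ (ch₁ ++ (black , node (A ∷ Δ) ch') ∷ ch₂)))
  c◇₂ : ∀ C Γ ch₁ Δ ch' ch₂ A → ¬ IdApplies Ξ → AllSaturated Ξ → AllRealised Ξ →
       Ξ ≡ plug C (node Γ (ch₁ ++ (black , node Δ ch') ∷ ch₂)) →
       ◇ A ∈ Δ → A ∉ Γ →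
       Calls Ξ (plug C (node (A ∷ Γ) (ch₁ ++ (black , node Δ ch') ∷ ch₂)))
  c◆₂ : ∀ C Γ ch₁ Δ ch' ch₂ A → ¬ IdApplies Ξ → AllSaturated Ξ → AllRealised Ξ →
       Ξ ≡ plug C (node Γ (ch₁ ++ (white , node Δ ch') ∷ ch₂)) →
       ◆ A ∈ Δ → A ∉ Γ →
       Calls Ξ (plug C (node (A ∷ Γ) (ch₁ ++ (white , node Δ ch') ∷ ch₂)))

CalledBy : Seq → Seq → Set
CalledBy Ξ' Ξ = Calls Ξ Ξ'

-- Let L be the subformula closure of the input and r a bound on modal degree
-- plus depth.  Each call of Prove adds to some node a formula of L it lacked, or
-- adds a child realising a box formula that was unrealised; formulas at depth d
-- keep degree below r - d, so the tree never gets deeper than r.  The potential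
-- of a node is the number of formulas of L it lacks, plus the potentials of its
-- children, plus, for each (label, formula) pair not yet realised by a child, a
-- weight larger than the potential of any fresh child.  Every call strictly
-- decreases the potential of the root.
module Submission where

open import Defs
open import Data.Nat.Base using (ℕ; zero; suc; pred; _+_; _*_; _≤_; _<_; _⊔_; z≤n; s≤s)
open import Data.Nat.Properties
open import Data.Nat.Induction using (<-wellFounded)
open import Data.Nat.Tactic.RingSolver using (solve-∀)
open import Data.List.Base using (List; []; _∷_; _++_; [_]; length; filter; foldr; concatMap)
open import Data.List.Properties using (length-filter; filter-accept; filter-reject)
open import Data.List.Membership.Propositional using (_∈_; _∉_; find)
open import Data.List.Membership.Propositional.Properties
  using (∈-++⁺ˡ; ∈-++⁺ʳ; ∈-++⁻; ∈-concatMap⁺; ∈-concatMap⁻)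
open import Data.List.Relation.Binary.Subset.Propositional using (_⊆_)
open import Data.List.Relation.Unary.Any as Any using (Any; here; there; any?)
open import Data.List.Relation.Unary.All as All using (All; []; _∷_)
import Data.List.Relation.Unary.All.Properties as All
open import Data.Product.Base using (_×_; _,_; proj₁; proj₂)
open import Data.Sum.Base using ([_,_]′; inj₁; inj₂)
open import Data.Unit.Base using (⊤; tt)
open import Data.Empty using (⊥-elim)
open import Function.Base using (id; _∘_)
open import Induction.WellFounded using (WellFounded; Acc; acc)
open import Relation.Binary.Core using (Rel)
open import Relation.Binary.Definitions using (DecidableEquality)
open import Relation.Binary.PropositionalEquality using (_≡_; refl; cong; cong₂)
open import Relation.Nullary using (¬_; Dec; yes; no)
open import Relation.Nullary.Decidable using (map′; _×-dec_; ¬?)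
open import Relation.Unary using (Pred; Decidable)

_≟ˡ_ : DecidableEquality Lbl
white ≟ˡ white = yes refl
white ≟ˡ black = no λ ()
black ≟ˡ white = no λ ()
black ≟ˡ black = yes refl

constructorIndex : Fml → ℕ
constructorIndex (pos _) = 0
constructorIndex (neg _) = 1
constructorIndex (_ ∨ _) = 2
constructorIndex (_ ∧ _) = 3
constructorIndex (□ _)   = 4
constructorIndex (■ _)   = 5
constructorIndex (◇ _)   = 6
constructorIndex (◆ _)   = 7

_≟ᶠ_ : DecidableEquality Fml
≟ᶠ-sameConstructor : ∀ F G → constructorIndex F ≡ constructorIndex G → Dec (F ≡ G)

F ≟ᶠ G with constructorIndex F ≟ constructorIndex G
... | yes same = ≟ᶠ-sameConstructor F G same
... | no differ = no (differ ∘ cong constructorIndex)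

-- Clauses for distinct constructors are omitted: the index equation is absurd there.
≟ᶠ-sameConstructor (pos m) (pos n) refl = map′ (cong pos) (λ { refl → refl }) (m ≟ n)
≟ᶠ-sameConstructor (neg m) (neg n) refl = map′ (cong neg) (λ { refl → refl }) (m ≟ n)
≟ᶠ-sameConstructor (A ∨ B) (C ∨ D) refl =
  map′ (λ (p , q) → cong₂ _∨_ p q) (λ { refl → refl , refl }) (A ≟ᶠ C ×-dec B ≟ᶠ D)
≟ᶠ-sameConstructor (A ∧ B) (C ∧ D) refl =
  map′ (λ (p , q) → cong₂ _∧_ p q) (λ { refl → refl , refl }) (A ≟ᶠ C ×-dec B ≟ᶠ D)
≟ᶠ-sameConstructor (□ A) (□ B) refl = map′ (cong □) (λ { refl → refl }) (A ≟ᶠ B)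
≟ᶠ-sameConstructor (■ A) (■ B) refl = map′ (cong ■) (λ { refl → refl }) (A ≟ᶠ B)
≟ᶠ-sameConstructor (◇ A) (◇ B) refl = map′ (cong ◇) (λ { refl → refl }) (A ≟ᶠ B)
≟ᶠ-sameConstructor (◆ A) (◆ B) refl = map′ (cong ◆) (λ { refl → refl }) (A ≟ᶠ B)

open import Data.List.Membership.DecPropositional _≟ᶠ_ using (_∈?_)

acc-by-measure : ∀ {a ℓ i} {X : Set a} {_≺_ : Rel X ℓ} (I : Pred X i) (f : X → ℕ) →
                 (∀ {x y} → y ≺ x → I x → I y × f y < f x) →
                 ∀ {x} → I x → Acc _≺_ x
acc-by-measure {_≺_ = _≺_} I f step {x} Ix = go x Ix (<-wellFounded (f x))
  where
  go : ∀ x → I x → Acc _<_ (f x) → Acc _≺_ x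
  go x Ix (acc smaller) = acc λ y≺x → let Iy , fy<fx = step y≺x Ix in go _ Iy (smaller fy<fx)

module _ {a p q} {X : Set a} {P : Pred X p} {Q : Pred X q}
         (P? : Decidable P) (Q? : Decidable Q) (P⊆Q : ∀ {x} → P x → Q x) where

  length-filter-mono : ∀ xs → length (filter P? xs) ≤ length (filter Q? xs)
  length-filter-mono [] = z≤n
  length-filter-mono (x ∷ xs) with P? x | Q? x
  ... | yes _  | yes _  = s≤s (length-filter-mono xs)
  ... | yes Px | no ¬Qx = ⊥-elim (¬Qx (P⊆Q Px))
  ... | no _   | yes _  = m≤n⇒m≤1+n (length-filter-mono xs)
  ... | no _   | no _   = length-filter-mono xs

  length-filter-mono-< : ∀ {x xs} → x ∈ xs → ¬ P x → Q x →
                         length (filter P? xs) < length (filter Q? xs)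
  length-filter-mono-< {xs = y ∷ xs} (here refl) ¬Py Qy
    rewrite filter-reject P? {xs = xs} ¬Py | filter-accept Q? {xs = xs} Qy =
    s≤s (length-filter-mono xs)
  length-filter-mono-< {xs = y ∷ xs} (there x∈xs) ¬Px Qx with P? y | Q? y
  ... | yes _  | yes _  = s≤s (length-filter-mono-< x∈xs ¬Px Qx)
  ... | yes Py | no ¬Qy = ⊥-elim (¬Qy (P⊆Q Py))
  ... | no _   | yes _  = m<n⇒m<1+n (length-filter-mono-< x∈xs ¬Px Qx)
  ... | no _   | no _   = length-filter-mono-< x∈xs ¬Px Qx

Any-replace : ∀ {a p} {X : Set a} {P : Pred X p} {x y : X} {ys} xs →
              (P x → P y) → Any P (xs ++ x ∷ ys) → Any P (xs ++ y ∷ ys)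
Any-replace []       f (here Px)  = here (f Px)
Any-replace []       f (there Pz) = there Pz
Any-replace (_ ∷ xs) f (here Pz)  = here Pz
Any-replace (_ ∷ xs) f (there Pz) = there (Any-replace xs f Pz)

+-*-trade-< : ∀ a b {n k s s'} → n < k → s' < s → a + (n + b) + k * s' < a + b + k * s
+-*-trade-< a b {n} {k} {s} {s'} n<k s'<s = begin-strict
  a + (n + b) + k * s'  ≡⟨ regroup a b n (k * s') ⟩
  a + b + (n + k * s')  <⟨ +-monoʳ-< (a + b) (+-monoˡ-< (k * s') n<k) ⟩
  a + b + (k + k * s')  ≡⟨ cong (a + b +_) (*-suc k s') ⟨
  a + b + k * suc s'    ≤⟨ +-monoʳ-≤ (a + b) (*-monoʳ-≤ k s'<s) ⟩
  a + b + k * s         ∎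
  where
  open ≤-Reasoning
  regroup : ∀ a b n c → a + (n + b) + c ≡ a + b + (n + c)
  regroup = solve-∀

deg : Fml → ℕ
deg (pos _) = 0
deg (neg _) = 0
deg (A ∨ B) = deg A ⊔ deg B
deg (A ∧ B) = deg A ⊔ deg B
deg (□ A)   = suc (deg A)
deg (■ A)   = suc (deg A)
deg (◇ A)   = suc (deg A)
deg (◆ A)   = suc (deg A)

infix 4 _≺_

data _≺_ : Fml → Fml → Set where
  ≺∨ˡ : ∀ {A B} → A ≺ A ∨ B
  ≺∨ʳ : ∀ {A B} → B ≺ A ∨ B
  ≺∧ˡ : ∀ {A B} → A ≺ A ∧ B
  ≺∧ʳ : ∀ {A B} → B ≺ A ∧ B
  ≺□  : ∀ {A} → A ≺ □ A
  ≺■  : ∀ {A} → A ≺ ■ A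
  ≺◇  : ∀ {A} → A ≺ ◇ A
  ≺◆  : ∀ {A} → A ≺ ◆ A

deg-≺ : ∀ {A F} → A ≺ F → deg A ≤ deg F
deg-≺ (≺∨ˡ {A} {B}) = m≤m⊔n (deg A) (deg B)
deg-≺ (≺∨ʳ {A} {B}) = m≤n⊔m (deg A) (deg B)
deg-≺ (≺∧ˡ {A} {B}) = m≤m⊔n (deg A) (deg B)
deg-≺ (≺∧ʳ {A} {B}) = m≤n⊔m (deg A) (deg B)
deg-≺ ≺□ = n≤1+n _
deg-≺ ≺■ = n≤1+n _
deg-≺ ≺◇ = n≤1+n _
deg-≺ ≺◆ = n≤1+n _

SubformulaClosed : List Fml → Set
SubformulaClosed L = ∀ {A F} → A ≺ F → F ∈ L → A ∈ L

subformulas properSubformulas : Fml → List Fml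
subformulas F = F ∷ properSubformulas F
properSubformulas (pos _) = []
properSubformulas (neg _) = []
properSubformulas (A ∨ B) = subformulas A ++ subformulas B
properSubformulas (A ∧ B) = subformulas A ++ subformulas B
properSubformulas (□ A)   = subformulas A
properSubformulas (■ A)   = subformulas A
properSubformulas (◇ A)   = subformulas A
properSubformulas (◆ A)   = subformulas A

≺⇒∈subformulas : ∀ {A F} → A ≺ F → A ∈ subformulas F
≺⇒∈subformulas (≺∨ˡ {B = B}) = there (∈-++⁺ˡ {ys = subformulas B} (here refl))
≺⇒∈subformulas (≺∨ʳ {A}) = there (∈-++⁺ʳ (subformulas A) (here refl))
≺⇒∈subformulas (≺∧ˡ {B = B}) = there (∈-++⁺ˡ {ys = subformulas B} (here refl))
≺⇒∈subformulas (≺∧ʳ {A}) = there (∈-++⁺ʳ (subformulas A) (here refl))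
≺⇒∈subformulas ≺□ = there (here refl)
≺⇒∈subformulas ≺■ = there (here refl)
≺⇒∈subformulas ≺◇ = there (here refl)
≺⇒∈subformulas ≺◆ = there (here refl)

subformulas-trans : ∀ {F} G → F ∈ subformulas G → subformulas F ⊆ subformulas G
properSubformulas-trans : ∀ {F} G → F ∈ properSubformulas G → subformulas F ⊆ properSubformulas G

subformulas-trans G (here refl) = id
subformulas-trans G (there F∈G) = there ∘ properSubformulas-trans G F∈G

properSubformulas-trans (A ∨ B) F∈G with ∈-++⁻ (subformulas A) F∈G
... | inj₁ F∈A = ∈-++⁺ˡ ∘ subformulas-trans A F∈A
... | inj₂ F∈B = ∈-++⁺ʳ (subformulas A) ∘ subformulas-trans B F∈B
properSubformulas-trans (A ∧ B) F∈G with ∈-++⁻ (subformulas A) F∈G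
... | inj₁ F∈A = ∈-++⁺ˡ ∘ subformulas-trans A F∈A
... | inj₂ F∈B = ∈-++⁺ʳ (subformulas A) ∘ subformulas-trans B F∈B
properSubformulas-trans (□ A) F∈G = subformulas-trans A F∈G
properSubformulas-trans (■ A) F∈G = subformulas-trans A F∈G
properSubformulas-trans (◇ A) F∈G = subformulas-trans A F∈G
properSubformulas-trans (◆ A) F∈G = subformulas-trans A F∈G

subformulas-closed : ∀ Fs → SubformulaClosed (concatMap subformulas Fs)
subformulas-closed Fs A≺F F∈L =
  ∈-concatMap⁺ subformulas (Any.map (λ {G} F∈G → subformulas-trans G F∈G (≺⇒∈subformulas A≺F))
                                    (∈-concatMap⁻ subformulas {xs = Fs} F∈L))

⊆-subformulas : ∀ Fs → Fs ⊆ concatMap subformulas Fs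
⊆-subformulas Fs F∈Fs = ∈-concatMap⁺ subformulas (Any.map (λ { refl → here refl }) F∈Fs)

root : Seq → List Fml
root (node Γ _) = Γ

leaf : Fml → Seq
leaf A = node [ A ] []

plug-root-⊆ : ∀ C {s s'} → root s ⊆ root s' → root (plug C s) ⊆ root (plug C s')
plug-root-⊆ hole grows = grows
plug-root-⊆ (under _ _ _ _ _) _ = id

formulas : Seq → List Fml
formulasᶜ : List (Lbl × Seq) → List Fml
formulas (node Γ ch) = Γ ++ formulasᶜ ch
formulasᶜ [] = []
formulasᶜ ((_ , s) ∷ ch) = formulas s ++ formulasᶜ ch

maxDeg : List Fml → ℕ
maxDeg = foldr (λ F n → deg F ⊔ n) 0

deg≤maxDeg : ∀ {F Γ} → F ∈ Γ → deg F ≤ maxDeg Γ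
deg≤maxDeg {Γ = G ∷ Γ} (here refl) = m≤m⊔n (deg G) (maxDeg Γ)
deg≤maxDeg {Γ = G ∷ Γ} (there F∈Γ) = ≤-trans (deg≤maxDeg F∈Γ) (m≤n⊔m (deg G) (maxDeg Γ))

initialLevel : Seq → ℕ
initialLevelᶜ : List (Lbl × Seq) → ℕ
initialLevel (node Γ ch) = suc (maxDeg Γ ⊔ initialLevelᶜ ch)
initialLevelᶜ [] = 0
initialLevelᶜ ((_ , s) ∷ ch) = initialLevel s ⊔ initialLevelᶜ ch

Realises : Lbl → Fml → Lbl × Seq → Set
Realises x A (y , s) = y ≡ x × A ∈ root s

realises? : ∀ x A → Decidable (Realises x A)
realises? x A (y , s) = (y ≟ˡ x) ×-dec (A ∈? root s)

realised⇒HasChildWith : ∀ {x A ch} → Any (Realises x A) ch → HasChildWith x A ch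
realised⇒HasChildWith realised with find realised
... | (_ , node Δ ch') , child∈ch , refl , A∈Δ = Δ , ch' , child∈ch , A∈Δ

module Potential (L : List Fml) (closed : SubformulaClosed L) where

  Below : ℕ → Fml → Set
  Below r F = F ∈ L × deg F < r

  below-≺ : ∀ {r A F} → A ≺ F → Below r F → Below r A
  below-≺ A≺F (F∈L , F<r) = closed A≺F F∈L , ≤-<-trans (deg-≺ A≺F) F<r

  below-≺-pred : ∀ {r A F} → A ≺ F → deg A < deg F → Below r F → Below (pred r) A
  below-≺-pred A≺F A<F (F∈L , F<r) = closed A≺F F∈L , suc[m]≤n⇒m≤pred[n] (<-≤-trans (s≤s A<F) F<r)

  below-mono : ∀ {r r' F} → r ≤ r' → Below r F → Below r' F
  below-mono r≤r' (F∈L , F<r) = F∈L , <-≤-trans F<r r≤r'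

  Inv : ℕ → Seq → Set
  Invᶜ : ℕ → List (Lbl × Seq) → Set
  Inv r (node Γ ch) = All (Below r) Γ × Invᶜ (pred r) ch
  Invᶜ r [] = ⊤
  Invᶜ r ((_ , s) ∷ ch) = Inv r s × Invᶜ r ch

  Inv-root : ∀ {r Γ ch F} → Inv r (node Γ ch) → F ∈ Γ → Below r F
  Inv-root (invΓ , _) = All.lookup invΓ

  Invᶜ-focus : ∀ {r x s ch₂} ch₁ → Invᶜ r (ch₁ ++ (x , s) ∷ ch₂) →
               Inv r s × (∀ {s'} → Inv r s' → Invᶜ r (ch₁ ++ (x , s') ∷ ch₂))
  Invᶜ-focus [] (inv-s , inv-ch₂) = inv-s , (_, inv-ch₂)
  Invᶜ-focus (_ ∷ ch₁) (inv-c , inv-rest) =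
    let inv-s , rebuild = Invᶜ-focus ch₁ inv-rest in inv-s , (inv-c ,_) ∘ rebuild

  Inv-child : ∀ {r Γ x s ch₂} ch₁ → Inv r (node Γ (ch₁ ++ (x , s) ∷ ch₂)) → Inv (pred r) s
  Inv-child ch₁ (_ , inv-ch) = proj₁ (Invᶜ-focus ch₁ inv-ch)

  Inv-init : ∀ s {r} → formulas s ⊆ L → initialLevel s ≤ r → Inv r s
  Invᶜ-init : ∀ ch {r} → formulasᶜ ch ⊆ L → initialLevelᶜ ch ≤ r → Invᶜ r ch
  Inv-init (node Γ ch) {r} ⊆L level≤r = All.tabulate below , Invᶜ-init ch (⊆L ∘ ∈-++⁺ʳ Γ) children≤
    where
    below : ∀ {F} → F ∈ Γ → Below r F
    below F∈Γ = ⊆L (∈-++⁺ˡ F∈Γ) , <-≤-trans (s≤s (≤-trans (deg≤maxDeg F∈Γ) (m≤m⊔n _ _))) level≤r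
    children≤ : initialLevelᶜ ch ≤ pred r
    children≤ = ≤-trans (m≤n⊔m (maxDeg Γ) _) (suc[m]≤n⇒m≤pred[n] level≤r)
  Invᶜ-init [] _ _ = tt
  Invᶜ-init ((_ , s) ∷ ch) ⊆L level≤r =
    Inv-init s (⊆L ∘ ∈-++⁺ˡ) (≤-trans (m≤m⊔n _ _) level≤r) ,
    Invᶜ-init ch (⊆L ∘ ∈-++⁺ʳ (formulas s)) (≤-trans (m≤n⊔m (initialLevel s) _) level≤r)

  missing : List Fml → ℕ
  missing Γ = length (filter (λ F → ¬? (F ∈? Γ)) L)

  unrealised : Lbl → List (Lbl × Seq) → ℕ
  unrealised x ch = length (filter (λ A → ¬? (any? (realises? x A) ch)) L)

  openSlots : List (Lbl × Seq) → ℕ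
  openSlots ch = unrealised white ch + unrealised black ch

  missing-< : ∀ {A Γ Γ'} → Γ ⊆ Γ' → A ∈ L → A ∈ Γ' → A ∉ Γ → missing Γ' < missing Γ
  missing-< Γ⊆Γ' A∈L A∈Γ' A∉Γ =
    length-filter-mono-< _ _ (λ ∉Γ' → ∉Γ' ∘ Γ⊆Γ') A∈L (λ A∉Γ' → A∉Γ' A∈Γ') A∉Γ

  unrealised-replace : ∀ {y x s s' ch₂} ch₁ → root s ⊆ root s' →
                       unrealised y (ch₁ ++ (x , s') ∷ ch₂) ≤ unrealised y (ch₁ ++ (x , s) ∷ ch₂)
  unrealised-replace ch₁ grows =
    length-filter-mono _ _ (λ ¬new old → ¬new (Any-replace ch₁ (λ (x≡y , A∈s) → x≡y , grows A∈s) old))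
                       L

  unrealised-cons-≤ : ∀ y c ch → unrealised y (c ∷ ch) ≤ unrealised y ch
  unrealised-cons-≤ y c ch = length-filter-mono _ _ (λ ¬new old → ¬new (there old)) L

  unrealised-cons-< : ∀ {x A c ch} → A ∈ L → Realises x A c → ¬ Any (Realises x A) ch →
                      unrealised x (c ∷ ch) < unrealised x ch
  unrealised-cons-< A∈L realised unrealisedA =
    length-filter-mono-< _ _ (λ ¬new old → ¬new (there old))
                         A∈L (λ ¬new → ¬new (here realised)) unrealisedA

  openSlots-replace : ∀ {x s s' ch₂} ch₁ → root s ⊆ root s' →
                      openSlots (ch₁ ++ (x , s') ∷ ch₂) ≤ openSlots (ch₁ ++ (x , s) ∷ ch₂)
  openSlots-replace ch₁ grows = +-mono-≤ (unrealised-replace ch₁ grows) (unrealised-replace ch₁ grows)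

  openSlots-new-< : ∀ {x A ch} → A ∈ L → ¬ Any (Realises x A) ch →
                    openSlots ((x , leaf A) ∷ ch) < openSlots ch
  openSlots-new-< {white} {ch = ch} A∈L unrealisedA =
    +-mono-<-≤ (unrealised-cons-< A∈L (refl , here refl) unrealisedA) (unrealised-cons-≤ black _ ch)
  openSlots-new-< {black} {ch = ch} A∈L unrealisedA =
    +-mono-≤-< (unrealised-cons-≤ white _ ch) (unrealised-cons-< A∈L (refl , here refl) unrealisedA)

  missing≤ : ∀ Γ → missing Γ ≤ length L
  missing≤ Γ = length-filter _ L

  openSlots≤ : ∀ ch → openSlots ch ≤ length L + length L
  openSlots≤ ch = +-mono-≤ (length-filter _ L) (length-filter _ L)

  -- freshWeight r is the price of one open slot at level r: it exceeds the
  -- potential of a fresh leaf at level r.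
  freshWeight openSlotsBound : ℕ → ℕ
  freshWeight r = suc (length L + openSlotsBound r)
  openSlotsBound zero = 0
  openSlotsBound (suc r) = freshWeight r * (length L + length L)

  openSlotsCost : ℕ → List (Lbl × Seq) → ℕ
  openSlotsCost zero _ = 0
  openSlotsCost (suc r) ch = freshWeight r * openSlots ch

  Φ : ℕ → Seq → ℕ
  Φᶜ : ℕ → List (Lbl × Seq) → ℕ
  Φ r (node Γ ch) = missing Γ + Φᶜ (pred r) ch + openSlotsCost r ch
  Φᶜ r [] = 0
  Φᶜ r ((_ , s) ∷ ch) = Φ r s + Φᶜ r ch

  Φᶜ-replace-< : ∀ {r x s s' ch₂} ch₁ → Φ r s' < Φ r s →
                 Φᶜ r (ch₁ ++ (x , s') ∷ ch₂) < Φᶜ r (ch₁ ++ (x , s) ∷ ch₂)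
  Φᶜ-replace-< {ch₂ = ch₂} [] lt = +-monoˡ-< (Φᶜ _ ch₂) lt
  Φᶜ-replace-< ((_ , c) ∷ ch₁) lt = +-monoʳ-< (Φ _ c) (Φᶜ-replace-< ch₁ lt)

  openSlotsCost-mono : ∀ r {ch ch'} → openSlots ch' ≤ openSlots ch →
                       openSlotsCost r ch' ≤ openSlotsCost r ch
  openSlotsCost-mono zero _ = z≤n
  openSlotsCost-mono (suc r) le = *-monoʳ-≤ (freshWeight r) le

  Φ-leaf-< : ∀ r A → Φ r (leaf A) < freshWeight r
  Φ-leaf-< r A = s≤s (+-mono-≤ (≤-trans (≤-reflexive (+-identityʳ _)) (missing≤ [ A ])) (cost≤ r))
    where
    cost≤ : ∀ r → openSlotsCost r [] ≤ openSlotsBound r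
    cost≤ zero = z≤n
    cost≤ (suc r) = *-monoʳ-≤ (freshWeight r) (openSlots≤ [])

  Improves : ℕ → Seq → Seq → Set
  Improves r s s' = Inv r s → Inv r s' × Φ r s' < Φ r s

  improves-by-adding : ∀ {r Γ ch} Δ → (Inv r (node Γ ch) → All (Below r) Δ) → Any (_∉ Γ) Δ →
                       Improves r (node Γ ch) (node (Δ ++ Γ) ch)
  improves-by-adding {r} {Γ} {ch} Δ bounded new inv@(invΓ , inv-ch) =
    (All.++⁺ (bounded inv) invΓ , inv-ch) ,
    +-monoˡ-< (openSlotsCost r ch) (+-monoˡ-< (Φᶜ (pred r) ch)
      (missing-< (∈-++⁺ʳ Δ) (proj₁ (All.lookup (bounded inv) A∈Δ)) (∈-++⁺ˡ A∈Δ) A∉Γ))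
    where
    A∈Δ = proj₁ (proj₂ (find new))
    A∉Γ = proj₂ (proj₂ (find new))

  improves-by-new-child : ∀ {Γ ch} r x A → ¬ Any (Realises x A) ch →
                          (Inv r (node Γ ch) → Below (pred r) A) →
                          Improves r (node Γ ch) (node Γ ((x , leaf A) ∷ ch))
  improves-by-new-child zero x A _ bounded inv = ⊥-elim (n≮0 (proj₂ (bounded inv)))
  improves-by-new-child {Γ} {ch} (suc r) x A unrealisedA bounded inv@(invΓ , inv-ch) =
    (invΓ , ((bounded inv ∷ []) , tt) , inv-ch) ,
    +-*-trade-< (missing Γ) (Φᶜ r ch) (Φ-leaf-< r A) (openSlots-new-< (proj₁ (bounded inv)) unrealisedA)

  improves-child : ∀ {Γ x s s' ch₂} r ch₁ → root s ⊆ root s' →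
                   (Inv r (node Γ (ch₁ ++ (x , s) ∷ ch₂)) → Improves (pred r) s s') →
                   Improves r (node Γ (ch₁ ++ (x , s) ∷ ch₂)) (node Γ (ch₁ ++ (x , s') ∷ ch₂))
  improves-child {Γ} r ch₁ grows improves inv@(invΓ , inv-ch) =
    let inv-s , rebuild = Invᶜ-focus ch₁ inv-ch
        inv-s' , Φ-s'<Φ-s = improves inv inv-s
    in (invΓ , rebuild inv-s') ,
       +-mono-<-≤ (+-monoʳ-< (missing Γ) (Φᶜ-replace-< ch₁ Φ-s'<Φ-s))
                  (openSlotsCost-mono r (openSlots-replace ch₁ grows))

  improves-in-context : ∀ C {s s'} → root s ⊆ root s' → (∀ r → Improves r s s') →
                        ∀ r → Improves r (plug C s) (plug C s')
  improves-in-context hole _ improves = improves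
  improves-in-context (under _ ch₁ _ C _) grows improves r =
    improves-child r ch₁ (plug-root-⊆ C grows) (λ _ → improves-in-context C grows improves (pred r))

  call-improves : ∀ {Ξ Ξ'} → Calls Ξ Ξ' → ∀ r → Improves r Ξ Ξ'
  call-improves (c∨ C Γ ch A B _ refl A∨B∈Γ new) =
    improves-in-context C (∈-++⁺ʳ (A ∷ B ∷ [])) λ r →
      improves-by-adding (A ∷ B ∷ [])
        (λ inv → below-≺ ≺∨ˡ (Inv-root inv A∨B∈Γ) ∷ below-≺ ≺∨ʳ (Inv-root inv A∨B∈Γ) ∷ [])
        ([ here , there ∘ here ]′ new)
  call-improves (c∧₁ C Γ ch A B _ refl A∧B∈Γ A∉Γ _) =
    improves-in-context C there λ r →
      improves-by-adding [ A ] (λ inv → below-≺ ≺∧ˡ (Inv-root inv A∧B∈Γ) ∷ []) (here A∉Γ)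
  call-improves (c∧₂ C Γ ch A B _ refl A∧B∈Γ _ B∉Γ) =
    improves-in-context C there λ r →
      improves-by-adding [ B ] (λ inv → below-≺ ≺∧ʳ (Inv-root inv A∧B∈Γ) ∷ []) (here B∉Γ)
  call-improves (c□ C Γ ch A _ _ refl □A∈Γ no-child) =
    improves-in-context C id λ r →
      improves-by-new-child r white A (no-child ∘ realised⇒HasChildWith)
        (λ inv → below-≺-pred ≺□ (n<1+n _) (Inv-root inv □A∈Γ))
  call-improves (c■ C Γ ch A _ _ refl ■A∈Γ no-child) =
    improves-in-context C id λ r →
      improves-by-new-child r black A (no-child ∘ realised⇒HasChildWith)
        (λ inv → below-≺-pred ≺■ (n<1+n _) (Inv-root inv ■A∈Γ))
  call-improves (c◇₁ C Γ ch₁ Δ ch' ch₂ A _ _ _ refl ◇A∈Γ A∉Δ) =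
    improves-in-context C id λ r → improves-child r ch₁ there λ inv →
      improves-by-adding [ A ] (λ _ → below-≺-pred ≺◇ (n<1+n _) (Inv-root inv ◇A∈Γ) ∷ []) (here A∉Δ)
  call-improves (c◆₁ C Γ ch₁ Δ ch' ch₂ A _ _ _ refl ◆A∈Γ A∉Δ) =
    improves-in-context C id λ r → improves-child r ch₁ there λ inv →
      improves-by-adding [ A ] (λ _ → below-≺-pred ≺◆ (n<1+n _) (Inv-root inv ◆A∈Γ) ∷ []) (here A∉Δ)
  call-improves (c◇₂ C Γ ch₁ Δ ch' ch₂ A _ _ _ refl ◇A∈Δ A∉Γ) =
    improves-in-context C there λ r →
      improves-by-adding [ A ]
        (λ inv → below-mono pred[n]≤n (below-≺ ≺◇ (Inv-root (Inv-child ch₁ inv) ◇A∈Δ)) ∷ [])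
        (here A∉Γ)
  call-improves (c◆₂ C Γ ch₁ Δ ch' ch₂ A _ _ _ refl ◆A∈Δ A∉Γ) =
    improves-in-context C there λ r →
      improves-by-adding [ A ]
        (λ inv → below-mono pred[n]≤n (below-≺ ≺◆ (Inv-root (Inv-child ch₁ inv) ◆A∈Δ)) ∷ [])
        (here A∉Γ)

theorem7p4 : WellFounded CalledBy
theorem7p4 Ξ =
  acc-by-measure (Inv r) (Φ r) (λ call → call-improves call r) (Inv-init Ξ (⊆-subformulas (formulas Ξ)) ≤-refl)
  where
  open Potential (concatMap subformulas (formulas Ξ)) (subformulas-closed (formulas Ξ))
  r : ℕ
  r = initialLevel Ξ
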